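{- Let $(K_n,c)$ be a \textsc{Graph TSP} instance arising from the connected graph $G$, let $T$ be a tour with a fixed orientation, and for every edge $(u,v)\in T$ fix a shortest $u$-$v$ path in $G$. Call $(u',v')$ a subedge of $(u,v)\in T$ if $u'$ and $v'$ lie on the fixed shortest $u$-$v$ path and $c(u,u')<c(u,v')$. If $(a',b')$ and $(u',v')$ are subedges of two different edges $(a,b)$ and $(u,v)$ of $T$ with $c(a',b')+c(u',v')>c(a',u')+c(b',v')$, then $T$ is not 2-optimal.
   Context: A \textsc{Graph TSP} instance arises from a connected unweighted undirected graph $G$: the complete graph on $V(G)$ where $c(u,v)$ is the length of a shortest $u$-$v$ path in $G$. A tour is a Hamiltonian cycle; a 2-move replaces at most 2 edges of the tour by other edges to obtain a tour, and a tour is 2-optimal if no 2-move yields a shorter tour. -}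

module Defs where

open import Level using (0ℓ)
open import Data.Nat using (ℕ; zero; suc; _+_; _≤_; _<_; _<?_)
open import Data.Fin using (Fin; zero; suc; toℕ; fromℕ; fromℕ<; inject₁)
open import Data.List using (map; allFin)
open import Data.Nat.ListAction using (sum)
open import Data.Product using (Σ; ∃; ∃-syntax; _×_; _,_; proj₁)
open import Data.Sum using (_⊎_)
open import Relation.Nullary using (¬_; yes; no)
open import Relation.Binary.PropositionalEquality using (_≡_)
open import Function.Definitions using (Injective)

record Graph (n : ℕ) : Set₁ where
  field
    Adj   : Fin n → Fin n → Set
    sym   : ∀ {u v} → Adj u v → Adj v u
    irrefl : ∀ {u} → ¬ Adj u u
open Graph public

record Walk {n : ℕ} (G : Graph n) (u v : Fin n) (L : ℕ) : Set where
  field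
    vtx   : Fin (suc L) → Fin n
    start : vtx zero ≡ u
    end   : vtx (fromℕ L) ≡ v
    step  : ∀ (i : Fin L) → Adj G (vtx (inject₁ i)) (vtx (suc i))
open Walk public

IsShortestDist : {n : ℕ} → Graph n → Fin n → Fin n → ℕ → Set
IsShortestDist G u v d = Walk G u v d × (∀ L → Walk G u v L → d ≤ L)

-- c is the Graph TSP cost function arising from G (this also forces G
-- to be connected, since every pair of vertices has a walk).
IsGraphTSPCost : {n : ℕ} → Graph n → (Fin n → Fin n → ℕ) → Set
IsGraphTSPCost G c = ∀ u v → IsShortestDist G u v (c u v)

ShortestPath : {n : ℕ} → Graph n → (Fin n → Fin n → ℕ) → Fin n → Fin n → Set
ShortestPath G c u v = Walk G u v (c u v)

OnWalk : {n : ℕ} {G : Graph n} {u v : Fin n} {L : ℕ} → Fin n → Walk G u v L → Set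
OnWalk x p = ∃[ i ] vtx p i ≡ x

next : {n : ℕ} → Fin n → Fin n
next {suc k} i with suc (toℕ i) <? suc k
... | yes p = fromℕ< p
... | no _  = zero

-- A tour (Hamiltonian cycle of K_n) with a fixed orientation: an injective
-- (hence bijective) enumeration of the vertices; its edges are
-- (τ i , τ (next i)) for positions i.
Tour : ℕ → Set
Tour n = Σ (Fin n → Fin n) (Injective _≡_ _≡_)

pos : {n : ℕ} → Tour n → Fin n → Fin n
pos T = proj₁ T

tail head : {n : ℕ} → Tour n → Fin n → Fin n
tail T i = pos T i
head T i = pos T (next i)

cost : {n : ℕ} → (Fin n → Fin n → ℕ) → Tour n → ℕ
cost {n} c T = sum (map (λ i → c (tail T i) (head T i)) (allFin n))

IsTourEdge : {n : ℕ} → Tour n → Fin n → Fin n → Set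
IsTourEdge T x y =
  ∃[ j ] ((tail T j ≡ x × head T j ≡ y) ⊎ (tail T j ≡ y × head T j ≡ x))

-- T' arises from T by a 2-move: at most 2 edges of T are replaced,
-- i.e. there are (at most) two edge positions i, j of T such that every
-- other edge of T is still an edge of T'.
IsTwoMove : {n : ℕ} → Tour n → Tour n → Set
IsTwoMove T T' =
  ∃[ i ] ∃[ j ] (∀ k → ¬ k ≡ i → ¬ k ≡ j → IsTourEdge T' (tail T k) (head T k))

TwoOptimal : {n : ℕ} → (Fin n → Fin n → ℕ) → Tour n → Set
TwoOptimal c T = ∀ T' → IsTwoMove T T' → cost c T ≤ cost c T'

IsSubedge : {n : ℕ} {G : Graph n} (c : Fin n → Fin n → ℕ) (T : Tour n)
  (P : ∀ k → ShortestPath G c (tail T k) (head T k)) →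
  Fin n → Fin n → Fin n → Set
IsSubedge c T P k x y =
  OnWalk x (P k) × OnWalk y (P k) × c (tail T k) x < c (tail T k) y

module Submission where

-- Let (a , b) = (τ K , τ (K+1)) and (u , v) = (τ L , τ (L+1)) be the k-th
-- and l-th edges of the tour τ, with K < L.  Reversing the block of tour
-- positions K+1 … L yields a tour T' obtained from T by a 2-move: it
-- replaces (a , b), (u , v) by (a , u), (b , v) and keeps every other edge,
-- possibly traversed backwards.  Hence, c being symmetric,
--   cost T' + (c a b + c u v) = cost T + (c a u + c b v).
-- Since a', b' lie in this order on a shortest a-b path and u', v' on a
-- shortest u-v path, the triangle inequality gives
--   c a u + c b v ≤ (c a a' + c a' u' + c u u') + (c b' b + c b' v' + c v' v)
--                 < (c a a' + c a' b' + c b' b) + (c u u' + c u' v' + c v' v)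
--                 = c a b + c u v,
-- so T' is strictly shorter than T, and T is not 2-optimal.

open import Defs hiding (sym)
open import Data.Nat using (ℕ; zero; suc; _+_; _∸_; _≤_; _<_; z≤n; s≤s; s≤s⁻¹; _<?_; _≤?_)
open import Data.Nat.Properties hiding (_≟_)
open import Data.Nat.Tactic.RingSolver using (solve-∀)
open import Data.Nat.ListAction using () renaming (sum to listSum)
open import Data.Fin using (Fin; zero; suc; toℕ; fromℕ; fromℕ<; inject₁; punchIn; _≟_)
open import Data.Fin.Properties using (toℕ-injective; toℕ-fromℕ<; toℕ-inject₁; toℕ-fromℕ; toℕ<n; punchInᵢ≢i)
open import Data.Fin.Permutation using (permutation)
open import Data.List using (map; allFin; tabulate)
open import Data.List.Properties using (map-tabulate)
open import Data.Vec.Functional using (updateAt; removeAt)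
open import Data.Vec.Functional.Properties using (updateAt-updates; updateAt-minimal)
import Algebra.Properties.CommutativeMonoid.Sum as CommutativeMonoidSum
open import Data.Product using (Σ-syntax; _×_; _,_; proj₁; proj₂)
open import Data.Sum using (_⊎_; inj₁; inj₂)
open import Data.Empty using (⊥-elim)
open import Relation.Binary.Definitions using (tri<; tri≈; tri>)
open import Relation.Nullary using (¬_; yes; no)
open import Relation.Binary.PropositionalEquality

-- A walk of length L written as an ℕ-indexed vertex sequence (positions
-- beyond L are irrelevant).  In this form reversal, restriction and
-- concatenation of walks are plain index arithmetic.
record SeqWalk {n : ℕ} (G : Graph n) (u v : Fin n) (L : ℕ) : Set where
  field
    at       : ℕ → Fin n
    at-start : at 0 ≡ u
    at-end   : at L ≡ v
    at-adj   : ∀ i → i < L → Adj G (at i) (at (suc i))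
open SeqWalk

module _ {n : ℕ} {G : Graph n} where

  fromSeqWalk : ∀ {u v L} → SeqWalk G u v L → Walk G u v L
  fromSeqWalk {L = L} w = record
    { vtx   = λ j → at w (toℕ j)
    ; start = at-start w
    ; end   = trans (cong (at w) (toℕ-fromℕ L)) (at-end w)
    ; step  = λ i → subst (λ x → Adj G (at w x) (at w (suc (toℕ i))))
                      (sym (toℕ-inject₁ i)) (at-adj w (toℕ i) (toℕ<n i))
    }

  vertexAt : ∀ {u v L} → Walk G u v L → ℕ → Fin n
  vertexAt {u} {L = L} w i with i <? suc L
  ... | yes i≤L = vtx w (fromℕ< i≤L)
  ... | no  _   = u

  vertexAt-toℕ : ∀ {u v L} (w : Walk G u v L) (j : Fin (suc L)) → vertexAt w (toℕ j) ≡ vtx w j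
  vertexAt-toℕ {L = L} w j with toℕ j <? suc L
  ... | yes j≤L = cong (vtx w) (toℕ-injective (toℕ-fromℕ< j≤L))
  ... | no  j≰L = ⊥-elim (j≰L (toℕ<n j))

  toSeqWalk : ∀ {u v L} → Walk G u v L → SeqWalk G u v L
  toSeqWalk {L = L} w = record
    { at       = vertexAt w
    ; at-start = trans (vertexAt-toℕ w zero) (start w)
    ; at-end   = trans (cong (vertexAt w) (sym (toℕ-fromℕ L)))
                   (trans (vertexAt-toℕ w (fromℕ L)) (end w))
    ; at-adj   = adj
    }
    where
    at-position : ∀ (j : Fin (suc L)) {x} → toℕ j ≡ x → vtx w j ≡ vertexAt w x
    at-position j refl = sym (vertexAt-toℕ w j)

    adj : ∀ i → i < L → Adj G (vertexAt w i) (vertexAt w (suc i))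
    adj i i<L = subst₂ (Adj G)
      (at-position (inject₁ j) (trans (toℕ-inject₁ j) (toℕ-fromℕ< i<L)))
      (at-position (suc j) (cong suc (toℕ-fromℕ< i<L)))
      (step w j)
      where
      j : Fin L
      j = fromℕ< i<L

  reverse : ∀ {u v L} → SeqWalk G u v L → SeqWalk G v u L
  reverse {L = L} w = record
    { at       = λ i → at w (L ∸ i)
    ; at-start = at-end w
    ; at-end   = trans (cong (at w) (n∸n≡0 L)) (at-start w)
    ; at-adj   = λ i i<L →
        subst (λ x → Adj G (at w x) (at w (L ∸ suc i))) (sym (+-∸-assoc 1 i<L))
          (Graph.sym G (at-adj w (L ∸ suc i) (∸-monoʳ-< (s≤s z≤n) i<L)))
    }

  restrict : ∀ {u v L} (w : SeqWalk G u v L) {i j} → i ≤ j → j ≤ L →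
    SeqWalk G (at w i) (at w j) (j ∸ i)
  restrict w {i} {j} i≤j j≤L = record
    { at       = λ t → at w (i + t)
    ; at-start = cong (at w) (+-identityʳ i)
    ; at-end   = cong (at w) (m+[n∸m]≡n i≤j)
    ; at-adj   = λ t t<j∸i → subst (λ x → Adj G (at w (i + t)) (at w x)) (sym (+-suc i t))
        (at-adj w (i + t) (≤-trans (+-monoʳ-< i t<j∸i) (≤-trans (≤-reflexive (m+[n∸m]≡n i≤j)) j≤L)))
    }

  append : ∀ {u v w L M} → SeqWalk G u v L → SeqWalk G v w M → SeqWalk G u w (L + M)
  append {u} {v} {w} {L} {M} p q = record
    { at = h ; at-start = h-start ; at-end = h-end ; at-adj = h-adj }
    where
    h : ℕ → Fin n
    h i with i <? L
    ... | yes _ = at p i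
    ... | no  _ = at q (i ∸ L)

    h-start : h 0 ≡ u
    h-start with 0 <? L
    ... | yes _   = at-start p
    ... | no  0≮L = trans (cong (at q) (0∸n≡0 L)) (trans (at-start q)
                      (trans (sym (at-end p)) (trans (cong (at p) (n≤0⇒n≡0 (≮⇒≥ 0≮L))) (at-start p))))

    h-end : h (L + M) ≡ w
    h-end with L + M <? L
    ... | yes L+M<L = ⊥-elim (<⇒≱ L+M<L (m≤m+n L M))
    ... | no  _     = trans (cong (at q) (m+n∸m≡n L M)) (at-end q)

    h-adj : ∀ i → i < L + M → Adj G (h i) (h (suc i))
    h-adj i i<L+M with i <? L | suc i <? L
    ... | yes i<L | yes _     = at-adj p i i<L
    ... | yes i<L | no  1+i≮L = subst (Adj G (at p i)) junction (at-adj p i i<L)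
      where
      1+i≡L : suc i ≡ L
      1+i≡L = ≤-antisym i<L (≮⇒≥ 1+i≮L)
      junction : at p (suc i) ≡ at q (suc i ∸ L)
      junction = trans (cong (at p) 1+i≡L) (trans (at-end p) (trans (sym (at-start q))
                   (cong (at q) (sym (trans (cong (_∸ L) 1+i≡L) (n∸n≡0 L))))))
    ... | no  i≮L | yes 1+i<L = ⊥-elim (i≮L (≤-trans (n≤1+n _) 1+i<L))
    ... | no  i≮L | no  _     = subst (Adj G (at q (i ∸ L))) (cong (at q) (sym (+-∸-assoc 1 (≮⇒≥ i≮L))))
        (at-adj q (i ∸ L) (subst (i ∸ L <_) (m+n∸m≡n L M) (∸-monoˡ-< i<L+M (≮⇒≥ i≮L))))

regroup-detours : ∀ (A P U B Q V : ℕ) → (A + P + U) + (B + Q + V) ≡ (A + B + U + V) + (P + Q)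
regroup-detours = solve-∀

regroup-paths : ∀ (A R B U S V : ℕ) → (A + B + U + V) + (R + S) ≡ (A + R + B) + (U + S + V)
regroup-paths = solve-∀

module Metric {n : ℕ} {G : Graph n} {c : Fin n → Fin n → ℕ} (hc : IsGraphTSPCost G c) where

  dist-≤ : ∀ {u v L} → SeqWalk G u v L → c u v ≤ L
  dist-≤ {u} {v} {L} w = proj₂ (hc u v) L (fromSeqWalk w)

  geodesic : ∀ u v → SeqWalk G u v (c u v)
  geodesic u v = toSeqWalk (proj₁ (hc u v))

  c-sym : ∀ u v → c u v ≡ c v u
  c-sym u v = ≤-antisym (dist-≤ (reverse (geodesic v u))) (dist-≤ (reverse (geodesic u v)))

  c-triangle : ∀ x y z → c x z ≤ c x y + c y z
  c-triangle x y z = dist-≤ (append (geodesic x y) (geodesic y z))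

  detour : ∀ x y z w → c x w ≤ c x y + c y z + c z w
  detour x y z w = begin
    c x w                   ≤⟨ c-triangle x y w ⟩
    c x y + c y w           ≤⟨ +-monoʳ-≤ (c x y) (c-triangle y z w) ⟩
    c x y + (c y z + c z w) ≡⟨ sym (+-assoc (c x y) (c y z) (c z w)) ⟩
    c x y + c y z + c z w   ∎
    where open ≤-Reasoning

  module AlongShortestPath {a b : Fin n} (P : ShortestPath G c a b) where

    private
      w : SeqWalk G a b (c a b)
      w = toSeqWalk P

    stretch-≤ : ∀ {i j} → i ≤ j → j ≤ c a b → c (at w i) (at w j) ≤ j ∸ i
    stretch-≤ i≤j j≤L = dist-≤ (restrict w i≤j j≤L)

    to-end-≤ : ∀ {i} → i ≤ c a b → c (at w i) b ≤ c a b ∸ i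
    to-end-≤ {i} i≤L = subst (λ x → c (at w i) x ≤ c a b ∸ i) (at-end w) (stretch-≤ i≤L ≤-refl)

    dist-from-start : ∀ {i} → i ≤ c a b → c a (at w i) ≡ i
    dist-from-start {i} i≤L = ≤-antisym upper (+-cancelʳ-≤ (c a b ∸ i) i (c a (at w i)) lower)
      where
      open ≤-Reasoning
      upper : c a (at w i) ≤ i
      upper = subst (λ x → c x (at w i) ≤ i) (at-start w) (stretch-≤ z≤n i≤L)
      lower : i + (c a b ∸ i) ≤ c a (at w i) + (c a b ∸ i)
      lower = begin
        i + (c a b ∸ i)               ≡⟨ m+[n∸m]≡n i≤L ⟩
        c a b                         ≤⟨ c-triangle a (at w i) b ⟩
        c a (at w i) + c (at w i) b   ≤⟨ +-monoʳ-≤ (c a (at w i)) (to-end-≤ i≤L) ⟩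
        c a (at w i) + (c a b ∸ i)    ∎

    on-path : ∀ {x} → OnWalk x P → Σ[ i ∈ ℕ ] (i ≤ c a b × at w i ≡ x)
    on-path (j , refl) = toℕ j , s≤s⁻¹ (toℕ<n j) , vertexAt-toℕ P j

    subedge-split : ∀ {x y} → OnWalk x P → OnWalk y P → c a x < c a y →
      c a x + c x y + c y b ≤ c a b
    subedge-split x∈P y∈P ax<ay with on-path x∈P | on-path y∈P
    ... | i , i≤L , refl | j , j≤L , refl = begin
      c a (at w i) + c (at w i) (at w j) + c (at w j) b
        ≤⟨ +-mono-≤ (+-mono-≤ (≤-reflexive (dist-from-start i≤L)) (stretch-≤ i≤j j≤L)) (to-end-≤ j≤L) ⟩
      i + (j ∸ i) + (c a b ∸ j)  ≡⟨ cong (_+ (c a b ∸ j)) (m+[n∸m]≡n i≤j) ⟩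
      j + (c a b ∸ j)            ≡⟨ m+[n∸m]≡n j≤L ⟩
      c a b                      ∎
      where
      open ≤-Reasoning
      i≤j : i ≤ j
      i≤j = <⇒≤ (subst₂ _<_ (dist-from-start i≤L) (dist-from-start j≤L) ax<ay)

  open AlongShortestPath using (subedge-split)

  exchange-gain : ∀ {a b u v a' b' u' v'}
    (Pab : ShortestPath G c a b) (Puv : ShortestPath G c u v) →
    OnWalk a' Pab → OnWalk b' Pab → c a a' < c a b' →
    OnWalk u' Puv → OnWalk v' Puv → c u u' < c u v' →
    c a' u' + c b' v' < c a' b' + c u' v' →
    c a u + c b v < c a b + c u v
  exchange-gain {a} {b} {u} {v} {a'} {b'} {u'} {v'}
    Pab Puv a'∈ b'∈ a'<b' u'∈ v'∈ u'<v' shortcut = begin-strict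
      c a u + c b v
        ≤⟨ +-mono-≤ a-to-u b-to-v ⟩
      (c a a' + c a' u' + c u u') + (c b' b + c b' v' + c v' v)
        ≡⟨ regroup-detours (c a a') (c a' u') (c u u') (c b' b) (c b' v') (c v' v) ⟩
      rest + (c a' u' + c b' v')
        <⟨ +-monoʳ-< rest shortcut ⟩
      rest + (c a' b' + c u' v')
        ≡⟨ regroup-paths (c a a') (c a' b') (c b' b) (c u u') (c u' v') (c v' v) ⟩
      (c a a' + c a' b' + c b' b) + (c u u' + c u' v' + c v' v)
        ≤⟨ +-mono-≤ (subedge-split Pab a'∈ b'∈ a'<b') (subedge-split Puv u'∈ v'∈ u'<v') ⟩
      c a b + c u v ∎
    where
    open ≤-Reasoning
    rest : ℕ
    rest = c a a' + c b' b + c u u' + c v' v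
    a-to-u : c a u ≤ c a a' + c a' u' + c u u'
    a-to-u = subst (λ t → c a u ≤ c a a' + c a' u' + t) (c-sym u' u) (detour a a' u' u)
    b-to-v : c b v ≤ c b' b + c b' v' + c v' v
    b-to-v = subst (λ t → c b v ≤ t + c b' v' + c v' v) (c-sym b b') (detour b b' v' v)

open CommutativeMonoidSum +-0-commutativeMonoid using (sum; sum-remove; sum-permute; sum-cong-≗)

listSum≡sum : ∀ {n} (f : Fin n → ℕ) → listSum (map f (allFin n)) ≡ sum f
listSum≡sum {n} f = trans (cong listSum (map-tabulate (λ i → i) f)) (tabulated f)
  where
  tabulated : ∀ {m} (g : Fin m → ℕ) → listSum (tabulate g) ≡ sum g
  tabulated {zero}  g = refl
  tabulated {suc m} g = cong (g zero +_) (tabulated (λ i → g (suc i)))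

sum-involution : ∀ {n} (f : Fin n → ℕ) (π : Fin n → Fin n) → (∀ i → π (π i) ≡ i) →
  sum f ≡ sum (λ i → f (π i))
sum-involution f π π-inv = sum-permute f (permutation π π π-inv π-inv)

sum-differ-at : ∀ {n} (F f : Fin n → ℕ) (k : Fin n) → (∀ i → i ≢ k → F i ≡ f i) →
  sum F + f k ≡ sum f + F k
sum-differ-at {suc n} F f k agree = begin
  sum F + f k                         ≡⟨ cong (_+ f k) (sum-remove {i = k} F) ⟩
  F k + sum (removeAt F k) + f k      ≡⟨ cong (λ s → F k + s + f k) (sum-cong-≗ agree-off-k) ⟩
  F k + sum (removeAt f k) + f k      ≡⟨ swap-outer (F k) (sum (removeAt f k)) (f k) ⟩
  f k + sum (removeAt f k) + F k      ≡⟨ cong (_+ F k) (sym (sum-remove {i = k} f)) ⟩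
  sum f + F k                         ∎
  where
  open ≡-Reasoning
  agree-off-k : ∀ j → removeAt F k j ≡ removeAt f k j
  agree-off-k j = agree (punchIn k j) (punchInᵢ≢i k j)
  swap-outer : ∀ (x s y : ℕ) → x + s + y ≡ y + s + x
  swap-outer = solve-∀

sum-differ-at₂ : ∀ {n} (F f : Fin n → ℕ) {k l : Fin n} → k ≢ l →
  (∀ i → i ≢ k → i ≢ l → F i ≡ f i) → sum F + (f k + f l) ≡ sum f + (F k + F l)
sum-differ-at₂ F f {k} {l} k≢l agree = begin
  sum F + (f k + f l)   ≡⟨ shuffle (sum F) (f k) (f l) ⟩
  sum F + f l + f k     ≡⟨ cong (_+ f k) F-vs-H ⟩
  sum H + F l + f k     ≡⟨ shuffle′ (sum H) (F l) (f k) ⟩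
  sum H + f k + F l     ≡⟨ cong (_+ F l) (trans (sum-differ-at H f k H-off-k) (cong (sum f +_) H-k)) ⟩
  sum f + F k + F l     ≡⟨ +-assoc (sum f) (F k) (F l) ⟩
  sum f + (F k + F l)   ∎
  where
  open ≡-Reasoning
  H : Fin _ → ℕ
  H = updateAt f k (λ _ → F k)
  H-k : H k ≡ F k
  H-k = updateAt-updates k f
  H-off-k : ∀ i → i ≢ k → H i ≡ f i
  H-off-k i i≢k = updateAt-minimal i k f i≢k
  F≗H-off-l : ∀ i → i ≢ l → F i ≡ H i
  F≗H-off-l i i≢l with i ≟ k
  ... | yes refl = sym H-k
  ... | no  i≢k  = trans (agree i i≢k i≢l) (sym (H-off-k i i≢k))
  F-vs-H : sum F + f l ≡ sum H + F l
  F-vs-H = trans (cong (sum F +_) (sym (H-off-k l (λ l≡k → k≢l (sym l≡k)))))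
                 (sum-differ-at F H l F≗H-off-l)
  shuffle : ∀ (s x y : ℕ) → s + (x + y) ≡ s + y + x
  shuffle = solve-∀
  shuffle′ : ∀ (s x y : ℕ) → s + x + y ≡ s + y + x
  shuffle′ = solve-∀

SameEdge : ∀ {n} → Fin n → Fin n → Fin n → Fin n → Set
SameEdge x y x' y' = (x ≡ x' × y ≡ y') ⊎ (x ≡ y' × y ≡ x')

-- T' arises from T by exchanging the edges (a , b), (u , v) at positions
-- k, l for (a , u) at position k and (b , v) at position l; every other edge
-- of T reappears in T' (in either direction) at the position given by the
-- involution `match`.
record TwoExchange {n : ℕ} (T T' : Tour n) (k l : Fin n) : Set where
  field
    match            : Fin n → Fin n
    match-involutive : ∀ i → match (match i) ≡ i
    match-k          : match k ≡ k
    match-l          : match l ≡ l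
    kept             : ∀ m → m ≢ k → m ≢ l →
                       SameEdge (tail T' (match m)) (head T' (match m)) (tail T m) (head T m)
    tail-k           : tail T' k ≡ tail T k
    head-k           : head T' k ≡ tail T l
    tail-l           : tail T' l ≡ head T k
    head-l           : head T' l ≡ head T l

twoExchange⇒twoMove : ∀ {n} {T T' : Tour n} {k l} → TwoExchange T T' k l → IsTwoMove T T'
twoExchange⇒twoMove {k = k} {l} E = k , l , λ m m≢k m≢l → match m , kept m m≢k m≢l
  where open TwoExchange E

exchange-cost : ∀ {n} {c : Fin n → Fin n → ℕ} → (∀ x y → c x y ≡ c y x) →
  {T T' : Tour n} {k l : Fin n} → k ≢ l → TwoExchange T T' k l →
  cost c T' + (c (tail T k) (head T k) + c (tail T l) (head T l))
    ≡ cost c T + (c (tail T k) (tail T l) + c (head T k) (head T l))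
exchange-cost {n} {c} c-sym {T} {T'} {k} {l} k≢l E = begin
  cost c T' + (f k + f l)  ≡⟨ cong (_+ (f k + f l)) (trans (listSum≡sum g) (sum-involution g match match-involutive)) ⟩
  sum F + (f k + f l)      ≡⟨ sum-differ-at₂ F f k≢l F≗f ⟩
  sum f + (F k + F l)      ≡⟨ cong₂ _+_ (sym (listSum≡sum f)) (cong₂ _+_ F-k F-l) ⟩
  cost c T + (c (tail T k) (tail T l) + c (head T k) (head T l)) ∎
  where
  open ≡-Reasoning
  open TwoExchange E
  f g F : Fin n → ℕ
  f i = c (tail T i) (head T i)
  g i = c (tail T' i) (head T' i)
  F i = g (match i)
  same-cost : ∀ {x y x' y'} → SameEdge x y x' y' → c x y ≡ c x' y'
  same-cost (inj₁ (refl , refl)) = refl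
  same-cost (inj₂ (refl , refl)) = c-sym _ _
  F≗f : ∀ i → i ≢ k → i ≢ l → F i ≡ f i
  F≗f i i≢k i≢l = same-cost (kept i i≢k i≢l)
  F-k : F k ≡ c (tail T k) (tail T l)
  F-k = trans (cong g match-k) (cong₂ c tail-k head-k)
  F-l : F l ≡ c (head T k) (head T l)
  F-l = trans (cong g match-l) (cong₂ c tail-l head-l)

mirror : ℕ → ℕ → ℕ → ℕ
mirror A B x with A ≤? x | x ≤? B
... | yes _ | yes _ = A + B ∸ x
... | _     | _     = x

module Mirror (A B : ℕ) where

  mirror-inside : ∀ {x} → A ≤ x → x ≤ B → mirror A B x ≡ A + B ∸ x
  mirror-inside {x} A≤x x≤B with A ≤? x | x ≤? B
  ... | yes _   | yes _   = refl
  ... | no  A≰x | _       = ⊥-elim (A≰x A≤x)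
  ... | yes _   | no  x≰B = ⊥-elim (x≰B x≤B)

  mirror-below : ∀ {x} → x < A → mirror A B x ≡ x
  mirror-below {x} x<A with A ≤? x | x ≤? B
  ... | yes A≤x | yes _ = ⊥-elim (<⇒≱ x<A A≤x)
  ... | yes _   | no  _ = refl
  ... | no  _   | _     = refl

  mirror-above : ∀ {x} → B < x → mirror A B x ≡ x
  mirror-above {x} B<x with A ≤? x | x ≤? B
  ... | yes _ | yes x≤B = ⊥-elim (<⇒≱ B<x x≤B)
  ... | yes _ | no  _   = refl
  ... | no  _ | _       = refl

  mirror-image : ∀ {x} → A ≤ x → x ≤ B →
    A ≤ A + B ∸ x × A + B ∸ x ≤ B × (A + B ∸ x) + x ≡ A + B
  mirror-image {x} A≤x x≤B =
    subst (A ≤_) (sym (+-∸-assoc A x≤B)) (m≤m+n A (B ∸ x)) ,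
    ≤-trans (∸-monoˡ-≤ x (+-monoˡ-≤ B A≤x)) (≤-reflexive (m+n∸m≡n x B)) ,
    m∸n+n≡m (≤-trans x≤B (m≤n+m B A))

  interval-trichotomy : ∀ x → (A ≤ x × x ≤ B) ⊎ (x < A ⊎ B < x)
  interval-trichotomy x with A ≤? x | x ≤? B
  ... | yes A≤x | yes x≤B = inj₁ (A≤x , x≤B)
  ... | yes _   | no  x≰B = inj₂ (inj₂ (≰⇒> x≰B))
  ... | no  A≰x | _       = inj₂ (inj₁ (≰⇒> A≰x))

  mirror-involutive : ∀ x → mirror A B (mirror A B x) ≡ x
  mirror-involutive x with interval-trichotomy x
  ... | inj₁ (A≤x , x≤B) =
    let (A≤x' , x'≤B , _) = mirror-image A≤x x≤B in
    trans (cong (mirror A B) (mirror-inside A≤x x≤B))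
      (trans (mirror-inside A≤x' x'≤B) (m∸[m∸n]≡n (≤-trans x≤B (m≤n+m B A))))
  ... | inj₂ (inj₁ x<A) = trans (cong (mirror A B) (mirror-below x<A)) (mirror-below x<A)
  ... | inj₂ (inj₂ B<x) = trans (cong (mirror A B) (mirror-above B<x)) (mirror-above B<x)

  mirror-< : ∀ {x n} → B < n → x < n → mirror A B x < n
  mirror-< {x} {n} B<n x<n with interval-trichotomy x
  ... | inj₁ (A≤x , x≤B) = subst (_< n) (sym (mirror-inside A≤x x≤B))
                             (≤-<-trans (proj₁ (proj₂ (mirror-image A≤x x≤B))) B<n)
  ... | inj₂ (inj₁ x<A) = subst (_< n) (sym (mirror-below x<A)) x<n
  ... | inj₂ (inj₂ B<x) = subst (_< n) (sym (mirror-above B<x)) x<n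

sum∸summand : ∀ {p m s} → p + m ≡ s → s ∸ p ≡ m
sum∸summand {p} {m} refl = m+n∸m≡n p m

cyclicSuc : ℕ → ℕ → ℕ
cyclicSuc n x with suc x <? n
... | yes _ = suc x
... | no  _ = 0

cyclicSuc-< : ∀ {n x} → suc x < n → cyclicSuc n x ≡ suc x
cyclicSuc-< {n} {x} 1+x<n with suc x <? n
... | yes _     = refl
... | no  1+x≮n = ⊥-elim (1+x≮n 1+x<n)

cyclicSuc-cases : ∀ n x → cyclicSuc n x ≡ suc x ⊎ cyclicSuc n x ≡ 0
cyclicSuc-cases n x with suc x <? n
... | yes _ = inj₁ refl
... | no  _ = inj₂ refl

toℕ-next : ∀ {N} (i : Fin (suc N)) → toℕ (next i) ≡ cyclicSuc (suc N) (toℕ i)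
toℕ-next {N} i with suc (toℕ i) <? suc N
... | yes 1+i<n = toℕ-fromℕ< 1+i<n
... | no  _     = refl

-- Reversing the block of tour positions K+1 … L, where L = suc L' < n, in
-- positions 0 … n-1.  The new tour visits at position i the vertex that T
-- visits at ρ i.  For m ∉ {K , L}, the edge of T between positions m and
-- m+1 becomes the edge at position π m, where π reverses K+1 … L-1.
module BlockReversal (n K L' : ℕ) (K≤L' : K ≤ L') (L<n : suc L' < n) where

  ρ π : ℕ → ℕ
  ρ = mirror (suc K) (suc L')
  π = mirror (suc K) L'

  module ρ-mirror = Mirror (suc K) (suc L')
  module π-mirror = Mirror (suc K) L'

  -- the positions m, m+1 of T are those of π m + 1, π m in the new tour, in some order
  KeptEdge : ℕ → Set
  KeptEdge m = (ρ (π m) ≡ m × ρ (cyclicSuc n (π m)) ≡ cyclicSuc n m)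
             ⊎ (ρ (π m) ≡ cyclicSuc n m × ρ (cyclicSuc n (π m)) ≡ m)

  ρ-fixes-after-L : ∀ {m} → suc L' ≤ m → ρ (cyclicSuc n m) ≡ cyclicSuc n m
  ρ-fixes-after-L {m} L≤m with cyclicSuc-cases n m
  ... | inj₁ e = trans (cong ρ e) (trans (ρ-mirror.mirror-above (s≤s L≤m)) (sym e))
  ... | inj₂ e = trans (cong ρ e) (trans (ρ-mirror.mirror-below (s≤s z≤n)) (sym e))

  kept-before : ∀ {m} → m < K → KeptEdge m
  kept-before {m} m<K = inj₁ (trans (cong ρ π-m) ρ-m ,
                              trans (cong (λ x → ρ (cyclicSuc n x)) π-m) (trans (cong ρ succ-m) (trans ρ-1+m (sym succ-m))))
    where
    π-m : π m ≡ m
    π-m = π-mirror.mirror-below (≤-trans m<K (n≤1+n K))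
    ρ-m : ρ m ≡ m
    ρ-m = ρ-mirror.mirror-below (≤-trans m<K (n≤1+n K))
    succ-m : cyclicSuc n m ≡ suc m
    succ-m = cyclicSuc-< (≤-<-trans (≤-trans m<K K≤L') (<-trans (n<1+n L') L<n))
    ρ-1+m : ρ (suc m) ≡ suc m
    ρ-1+m = ρ-mirror.mirror-below (s≤s m<K)

  kept-inside : ∀ {m} → K < m → m ≤ L' → KeptEdge m
  kept-inside {m} K<m m≤L' = inj₂ (trans (cong ρ π-m) (trans ρ-p (sym succ-m)) ,
                                   trans (cong (λ x → ρ (cyclicSuc n x)) π-m) (trans (cong ρ succ-p) ρ-1+p))
    where
    p : ℕ
    p = suc K + L' ∸ m
    image = π-mirror.mirror-image K<m m≤L'
    K<p : K < p
    K<p = proj₁ image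
    p≤L' : p ≤ L'
    p≤L' = proj₁ (proj₂ image)
    p+m : p + m ≡ suc K + L'
    p+m = proj₂ (proj₂ image)
    π-m : π m ≡ p
    π-m = π-mirror.mirror-inside K<m m≤L'
    ρ-p : ρ p ≡ suc m
    ρ-p = trans (ρ-mirror.mirror-inside K<p (≤-trans p≤L' (n≤1+n L')))
            (sum∸summand (trans (+-suc p m) (trans (cong suc p+m) (sym (+-suc (suc K) L')))))
    ρ-1+p : ρ (suc p) ≡ m
    ρ-1+p = trans (ρ-mirror.mirror-inside (≤-trans K<p (n≤1+n p)) (s≤s p≤L'))
              (trans (cong (_∸ suc p) (+-suc (suc K) L')) (sum∸summand p+m))
    succ-m : cyclicSuc n m ≡ suc m
    succ-m = cyclicSuc-< (≤-<-trans (s≤s m≤L') L<n)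
    succ-p : cyclicSuc n p ≡ suc p
    succ-p = cyclicSuc-< (≤-<-trans (s≤s p≤L') L<n)

  kept-after : ∀ {m} → suc L' < m → KeptEdge m
  kept-after {m} L<m = inj₁ (trans (cong ρ π-m) (ρ-mirror.mirror-above L<m) ,
                             trans (cong (λ x → ρ (cyclicSuc n x)) π-m) (ρ-fixes-after-L (<⇒≤ L<m)))
    where
    π-m : π m ≡ m
    π-m = π-mirror.mirror-above (<-trans (n<1+n L') L<m)

  kept : ∀ m → m ≢ K → m ≢ suc L' → KeptEdge m
  kept m m≢K m≢L with <-cmp m K
  ... | tri< m<K _ _ = kept-before m<K
  ... | tri≈ _ m≡K _ = ⊥-elim (m≢K m≡K)
  ... | tri> _ _ K<m with <-cmp m (suc L')
  ...   | tri< m<L _ _ = kept-inside K<m (s≤s⁻¹ m<L)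
  ...   | tri≈ _ m≡L _ = ⊥-elim (m≢L m≡L)
  ...   | tri> _ _ L<m = kept-after L<m

  ρ-K : ρ K ≡ K
  ρ-K = ρ-mirror.mirror-below (n<1+n K)

  succ-K : cyclicSuc n K ≡ suc K
  succ-K = cyclicSuc-< (≤-<-trans (s≤s K≤L') L<n)

  ρ-after-K : ρ (cyclicSuc n K) ≡ suc L'
  ρ-after-K = trans (cong ρ succ-K) (trans (ρ-mirror.mirror-inside ≤-refl (s≤s K≤L')) (m+n∸m≡n (suc K) (suc L')))

  ρ-L : ρ (suc L') ≡ cyclicSuc n K
  ρ-L = trans (ρ-mirror.mirror-inside (s≤s K≤L') ≤-refl) (trans (m+n∸n≡m (suc K) (suc L')) (sym succ-K))

  π-K : π K ≡ K
  π-K = π-mirror.mirror-below (n<1+n K)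

  π-L : π (suc L') ≡ suc L'
  π-L = π-mirror.mirror-above (n<1+n L')

  ρ-< : ∀ {x} → x < n → ρ x < n
  ρ-< = ρ-mirror.mirror-< L<n

  π-< : ∀ {x} → x < n → π x < n
  π-< = π-mirror.mirror-< (<-trans (n<1+n L') L<n)

  ρ-involutive : ∀ x → ρ (ρ x) ≡ x
  ρ-involutive = ρ-mirror.mirror-involutive

  π-involutive : ∀ x → π (π x) ≡ x
  π-involutive = π-mirror.mirror-involutive

module _ {n : ℕ} (f : ℕ → ℕ) (f-< : ∀ {x} → x < n → f x < n) where

  restrictFin : Fin n → Fin n
  restrictFin i = fromℕ< (f-< (toℕ<n i))

  toℕ-restrictFin : ∀ i → toℕ (restrictFin i) ≡ f (toℕ i)
  toℕ-restrictFin i = toℕ-fromℕ< _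

  restrictFin-involutive : (∀ x → f (f x) ≡ x) → ∀ i → restrictFin (restrictFin i) ≡ i
  restrictFin-involutive f-inv i = toℕ-injective (begin
    toℕ (restrictFin (restrictFin i)) ≡⟨ toℕ-restrictFin (restrictFin i) ⟩
    f (toℕ (restrictFin i))           ≡⟨ cong f (toℕ-restrictFin i) ⟩
    f (f (toℕ i))                     ≡⟨ f-inv (toℕ i) ⟩
    toℕ i                             ∎)
    where open ≡-Reasoning

module _ {N : ℕ} (T : Tour (suc N)) {k l : Fin (suc N)} {L' : ℕ}
         (k≤L' : toℕ k ≤ L') (l≡1+L' : toℕ l ≡ suc L') where

  open BlockReversal (suc N) (toℕ k) L' k≤L' (subst (_< suc N) l≡1+L' (toℕ<n l))

  ρᶠ πᶠ : Fin (suc N) → Fin (suc N)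
  ρᶠ = restrictFin ρ ρ-<
  πᶠ = restrictFin π π-<

  -- the new tour visits every vertex exactly once since ρ is an involution
  ρᶠ-involutive : ∀ i → ρᶠ (ρᶠ i) ≡ i
  ρᶠ-involutive = restrictFin-involutive ρ ρ-< ρ-involutive

  reversed : Tour (suc N)
  reversed = (λ i → pos T (ρᶠ i)) , injective
    where
    injective : ∀ {i j} → pos T (ρᶠ i) ≡ pos T (ρᶠ j) → i ≡ j
    injective {i} {j} e = trans (sym (ρᶠ-involutive i)) (trans (cong ρᶠ (proj₂ T e)) (ρᶠ-involutive j))

  reversed-pos : ∀ i {j} → ρ (toℕ i) ≡ toℕ j → pos reversed i ≡ pos T j
  reversed-pos i e = cong (pos T) (toℕ-injective (trans (toℕ-restrictFin ρ ρ-< i) e))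

  next-after-πᶠ : ∀ m → toℕ (next (πᶠ m)) ≡ cyclicSuc (suc N) (π (toℕ m))
  next-after-πᶠ m = trans (toℕ-next (πᶠ m)) (cong (cyclicSuc (suc N)) (toℕ-restrictFin π π-< m))

  next-l : toℕ (next l) ≡ cyclicSuc (suc N) (suc L')
  next-l = trans (toℕ-next l) (cong (cyclicSuc (suc N)) l≡1+L')

  reversal-exchange : TwoExchange T reversed k l
  reversal-exchange = record
    { match            = πᶠ
    ; match-involutive = restrictFin-involutive π π-< π-involutive
    ; match-k          = toℕ-injective (trans (toℕ-restrictFin π π-< k) π-K)
    ; match-l          = toℕ-injective (trans (toℕ-restrictFin π π-< l)
                           (trans (cong π l≡1+L') (trans π-L (sym l≡1+L'))))
    ; kept             = kept-edge
    ; tail-k           = reversed-pos k ρ-K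
    ; head-k           = reversed-pos (next k) (trans (cong ρ (toℕ-next k)) (trans ρ-after-K (sym l≡1+L')))
    ; tail-l           = reversed-pos l (trans (cong ρ l≡1+L') (trans ρ-L (sym (toℕ-next k))))
    ; head-l           = reversed-pos (next l) (trans (cong ρ next-l) (trans (ρ-fixes-after-L ≤-refl) (sym next-l)))
    }
    where
    kept-edge : ∀ m → m ≢ k → m ≢ l →
      SameEdge (tail reversed (πᶠ m)) (head reversed (πᶠ m)) (tail T m) (head T m)
    kept-edge m m≢k m≢l
      with kept (toℕ m) (λ e → m≢k (toℕ-injective e)) (λ e → m≢l (toℕ-injective (trans e (sym l≡1+L'))))
    ... | inj₁ (e₁ , e₂) =
      inj₁ (reversed-pos (πᶠ m) (trans (cong ρ (toℕ-restrictFin π π-< m)) e₁) ,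
            reversed-pos (next (πᶠ m)) (trans (cong ρ (next-after-πᶠ m)) (trans e₂ (sym (toℕ-next m)))))
    ... | inj₂ (e₁ , e₂) =
      inj₂ (reversed-pos (πᶠ m) (trans (cong ρ (toℕ-restrictFin π π-< m)) (trans e₁ (sym (toℕ-next m)))) ,
            reversed-pos (next (πᶠ m)) (trans (cong ρ (next-after-πᶠ m)) e₂))

two-exchange-exists : ∀ {n} (T : Tour n) {k l : Fin n} → toℕ k < toℕ l →
  Σ[ T' ∈ Tour n ] TwoExchange T T' k l
two-exchange-exists {suc N} T {k} {l} k<l = split (toℕ l) refl k<l
  where
  split : ∀ y → toℕ l ≡ y → toℕ k < y → Σ[ T' ∈ Tour (suc N) ] TwoExchange T T' k l
  split (suc L') l≡1+L' (s≤s k≤L') = reversed T k≤L' l≡1+L' , reversal-exchange T k≤L' l≡1+L'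

improvable : ∀ {n} {G : Graph n} {c : Fin n → Fin n → ℕ} → IsGraphTSPCost G c →
  (T : Tour n) (P : ∀ k → ShortestPath G c (tail T k) (head T k)) →
  ∀ {k l a' b' u' v'} → toℕ k < toℕ l →
  IsSubedge c T P k a' b' → IsSubedge c T P l u' v' →
  c a' u' + c b' v' < c a' b' + c u' v' → ¬ TwoOptimal c T
improvable {c = c} hc T P {k} {l} k<l (a'∈ , b'∈ , a'<b') (u'∈ , v'∈ , u'<v') shortcut optimal
  with two-exchange-exists T k<l
... | T' , E = <⇒≱ shorter (optimal T' (twoExchange⇒twoMove E))
  where
  open Metric hc
  k≢l : k ≢ l
  k≢l k≡l = <-irrefl (cong toℕ k≡l) k<l
  shorter : cost c T' < cost c T
  shorter = +-cancelʳ-< _ (cost c T') (cost c T)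
    (≤-<-trans (≤-reflexive (exchange-cost c-sym k≢l E))
      (+-monoʳ-< (cost c T) (exchange-gain (P k) (P l) a'∈ b'∈ a'<b' u'∈ v'∈ u'<v' shortcut)))

-- The theorem: by symmetry of c we may assume that position k precedes l.
lemma65 : (n : ℕ) → 3 ≤ n → (G : Graph n) → (c : Fin n → Fin n → ℕ) →
    IsGraphTSPCost G c → (T : Tour n) →
    (P : ∀ k → ShortestPath G c (tail T k) (head T k)) →
    (k l : Fin n) → ¬ k ≡ l → (a' b' u' v' : Fin n) →
    IsSubedge c T P k a' b' → IsSubedge c T P l u' v' →
    c a' u' + c b' v' < c a' b' + c u' v' →
    ¬ TwoOptimal c T
lemma65 n _ G c hc T P k l k≢l a' b' u' v' sub-k sub-l shortcut with <-cmp (toℕ k) (toℕ l)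
... | tri< k<l _ _ = improvable hc T P k<l sub-k sub-l shortcut
... | tri≈ _ k≡l _ = ⊥-elim (k≢l (toℕ-injective k≡l))
... | tri> _ _ l<k = improvable hc T P l<k sub-l sub-k shortcut′
  where
  open Metric hc
  shortcut′ : c u' a' + c v' b' < c u' v' + c a' b'
  shortcut′ = subst₂ _<_ (cong₂ _+_ (c-sym a' u') (c-sym b' v')) (+-comm (c a' b') (c u' v')) shortcut
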